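{- Let $s\ge 2$, $p\ge 2$ be integers and let $G_{min}(s,p)$ be the graph in $\mathcal{G}(s,p)$ with the minimum number of edges. Then the number $\ell$ of non-integer Laplacian eigenvalues of $G_{min}(s,p)$ (counted with multiplicity) satisfies $\ell=0$ or $\ell=2$.
   Context: All graphs are finite, simple and connected. The Laplacian matrix of $G$ is $L(G)=\mathcal{D}(G)-A(G)$, with $\mathcal{D}(G)$ the diagonal degree matrix and $A(G)$ the adjacency matrix; its eigenvalues are the Laplacian eigenvalues of $G$. A vertex is simplicial if its neighbourhood is a clique. A minimal vertex separator is a set $S$ that, for some non-adjacent vertices $u,v$, separates $u$ and $v$ into different components of $G-S$ and is inclusion-minimal with this property. A graph is strictly chordal if it is obtained from a block graph (connected graph all of whose blocks are cliques) by adding zero or more true twins ($N[u]=N[v]$) to each vertex; a strictly interval graph is one that is both strictly chordal and an interval graph. For integers $s,p\ge 2$, $\mathcal{G}(s,p)$ is the set of $SI$-core graphs: strictly interval graphs $G$ with exactly two minimal vertex separators $S_1,S_2$, $|S_1|=|S_2|=s$, $S_1\cup S_2$ a maximal clique of $G$, and each $S_i$ having exactly $p$ simplicial vertices adjacent to it. Explicitly, $V(G)=S_1\cup S_2\cup P_1\cup P_2$ (disjoint), $|P_i|=p$, every vertex of $P_i$ is adjacent to all of $S_i$ and to no vertex of $S_{3-i}\cup P_{3-i}$, and $G[P_i]$ is a disjoint union of complete graphs. Thus $G_{min}(s,p)$ is the member in which $P_1$ and $P_2$ are independent sets. -}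

module Defs where

open import Data.Nat as ℕ using (ℕ; zero; suc; _<ᵇ_)
open import Data.Integer as ℤ using (ℤ; +_; _-_; _*_; _+_; -_)
open import Data.Fin using (Fin; zero; suc; toℕ; punchIn)
open import Data.Bool using (Bool; true; false; if_then_else_; _∧_; _∨_; not)
open import Data.List using (List; []; _∷_; length)
open import Data.Product using (Σ; _×_)
open import Relation.Binary.PropositionalEquality using (_≡_)
open import Relation.Nullary using (¬_)

∑ : ∀ {n} → (Fin n → ℤ) → ℤ
∑ {zero}  f = + 0
∑ {suc n} f = f zero + ∑ (λ i → f (suc i))

sign : ℕ → ℤ
sign zero          = + 1
sign (suc zero)    = - (+ 1)
sign (suc (suc k)) = sign k

det : ∀ {n} → (Fin n → Fin n → ℤ) → ℤ
det {zero}  M = + 1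
det {suc n} M =
  ∑ (λ j → sign (toℕ j) * (M zero j * det (λ i k → M (suc i) (punchIn j k))))

b2z : Bool → ℤ
b2z true  = + 1
b2z false = + 0

degree : ∀ {n} → (Fin n → Fin n → Bool) → Fin n → ℤ
degree A u = ∑ (λ v → b2z (A u v))

eqFin : ∀ {n} → Fin n → Fin n → Bool
eqFin zero    zero    = true
eqFin zero    (suc _) = false
eqFin (suc _) zero    = false
eqFin (suc i) (suc j) = eqFin i j

laplacian : ∀ {n} → (Fin n → Fin n → Bool) → Fin n → Fin n → ℤ
laplacian A u v = if eqFin u v then degree A u else - b2z (A u v)

charPoly : ∀ {n} → (Fin n → Fin n → Bool) → ℤ → ℤ
charPoly A z = det (λ u v → (if eqFin u v then z else + 0) - laplacian A u v)

-- Integer polynomials as coefficient lists (constant term first)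

evalPoly : List ℤ → ℤ → ℤ
evalPoly []       z = + 0
evalPoly (c ∷ cs) z = c + z * evalPoly cs z

linProd : List ℤ → ℤ → ℤ
linProd []       z = + 1
linProd (a ∷ as) z = (z - a) * linProd as z

-- "The monic integer polynomial f (given as a function ℤ → ℤ) has exactly
-- m integer roots counted with multiplicity":
-- f = (x - a₁)⋯(x - aₘ) · q  with q an integer polynomial without integer roots.
-- (Polynomial identity is tested on all of ℤ, which is equivalent since ℤ is infinite.)
IntRootCount : (ℤ → ℤ) → ℕ → Set
IntRootCount f m =
  Σ (List ℤ) λ as → Σ (List ℤ) λ q →
    (length as ≡ m)
    × (∀ z → f z ≡ linProd as z * evalPoly q z)
    × (∀ z → ¬ (evalPoly q z ≡ + 0))

-- G_min(s,p): vertex set Fin (s + s + p + p), with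
--   S₁ = [0, s), S₂ = [s, 2s), P₁ = [2s, 2s+p), P₂ = [2s+p, 2s+2p).
-- S₁ ∪ S₂ is a clique, every vertex of Pᵢ is adjacent exactly to Sᵢ,
-- and P₁, P₂ are independent sets.

data Part : Set where
  S₁ S₂ P₁ P₂ : Part

part : (s p : ℕ) → ℕ → Part
part s p v =
  if v <ᵇ s then S₁ else
  (if v <ᵇ (s ℕ.+ s) then S₂ else
  (if v <ᵇ (s ℕ.+ s ℕ.+ p) then P₁ else P₂))

adjPart : Part → Part → Bool
adjPart S₁ S₁ = true
adjPart S₁ S₂ = true
adjPart S₂ S₁ = true
adjPart S₂ S₂ = true
adjPart S₁ P₁ = true
adjPart P₁ S₁ = true
adjPart S₂ P₂ = true
adjPart P₂ S₂ = true
adjPart _  _  = false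

Gmin : (s p : ℕ) → Fin (s ℕ.+ s ℕ.+ p ℕ.+ p) → Fin (s ℕ.+ s ℕ.+ p ℕ.+ p) → Bool
Gmin s p u v = not (eqFin u v) ∧ adjPart (part s p (toℕ u)) (part s p (toℕ v))

order : ℕ → ℕ → ℕ
order s p = s ℕ.+ s ℕ.+ p ℕ.+ p

{-# OPTIONS --safe #-}
-- Vertices of the same class S₁, S₂, P₁, P₂ are twins, so every entry of zI − L(G_min) depends only
-- on the classes of its row and column, plus z − θ(t) on the diagonal of a class-t row, θ(t) being
-- the number of neighbours of a class-t vertex counting itself when t is a clique class.
-- Subtracting the column of one twin from that of an adjacent twin and then adding the rows merges
-- them into one vertex carrying the sum of their weights and pulls out z − θ(t).  Collapsing every
-- class leaves the 4 × 4 quotient matrix, with determinant z (z − s − p) (z² − (3s + p) z + 2s²).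
-- So all Laplacian eigenvalues except the two roots of the quadratic are integers, and those two
-- are either both integers (one root r gives the other as 3s + p − r) or both not.  The number of
-- integer roots is well defined because f(x) − f(y) is divisible by x − y for integer polynomials,
-- which lets a common factor z − a be cancelled from a polynomial identity on ℤ.
module Submission where

open import Defs
open import Data.Nat using (ℕ; _≤_; _∸_)
open import Data.Product using (Σ; _×_)
open import Data.Sum using (_⊎_)
open import Relation.Binary.PropositionalEquality using (_≡_)

open import Data.Nat as ℕ using (zero; suc; s≤s; z≤n; _<ᵇ_)
import Data.Nat.Properties as ℕ
import Data.Nat.Divisibility as ℕ
import Data.Nat.Tactic.RingSolver as ℕ-Solver
open import Data.Integer as ℤ using (ℤ; +_; -[1+_]; _+_; _*_; _-_; -_; _^_; ∣_∣)
import Data.Integer.Properties as ℤ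
open import Data.Integer.Divisibility.Signed
  using (_∣_; divides; ∣-refl; ∣m∣n⇒∣m+n; ∣n⇒∣m*n; ∣m∣n⇒∣m-n; ∣⇒∣ᵤ)
open import Data.Integer.Tactic.RingSolver using (solve-∀)
open import Data.Integer.Solver using (module +-*-Solver)
open +-*-Solver using (Polynomial; con; var; _:+_; _:*_; _:-_; prove)
open import Data.Fin as Fin using (Fin; zero; suc; toℕ; punchIn; punchOut; inject₁; fromℕ<)
open import Data.Fin.Properties
  using (punchInᵢ≢i; punchIn-injective; punchIn-punchOut; toℕ-inject₁; suc-injective; toℕ-fromℕ<)
open import Data.Bool using (Bool; true; false; if_then_else_; not; _∧_)
open import Data.List using (List; []; _∷_; length; replicate; _++_)
import Data.List.Properties as List
open import Data.Vec using ([]; _∷_)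
open import Data.Product using (_,_; ∃; proj₁; proj₂)
open import Data.Sum using (inj₁; inj₂)
open import Data.Empty using (⊥-elim)
open import Function using (_∘_)
open import Relation.Nullary using (yes; no)
open import Relation.Binary.PropositionalEquality
  using (_≢_; refl; sym; trans; cong; cong₂; subst; module ≡-Reasoning)

open ≡-Reasoning

Mat : ℕ → Set
Mat n = Fin n → Fin n → ℤ

∑-cong : ∀ {n} {f g : Fin n → ℤ} → (∀ i → f i ≡ g i) → ∑ f ≡ ∑ g
∑-cong {zero}  f≗g = refl
∑-cong {suc n} f≗g = cong₂ _+_ (f≗g zero) (∑-cong (f≗g ∘ suc))

∑-zero : ∀ {n} {f : Fin n → ℤ} → (∀ i → f i ≡ + 0) → ∑ f ≡ + 0
∑-zero {zero}  f≗0 = refl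
∑-zero {suc n} f≗0 = cong₂ _+_ (f≗0 zero) (∑-zero (f≗0 ∘ suc))

∑-linear : ∀ {n} (f g h : Fin n → ℤ) (t : ℤ) → (∀ i → f i ≡ g i + t * h i) →
           ∑ f ≡ ∑ g + t * ∑ h
∑-linear {zero}  f g h t eq = sym (trans (ℤ.+-identityˡ (t * + 0)) (ℤ.*-zeroʳ t))
∑-linear {suc n} f g h t eq = begin
  f zero + ∑ (f ∘ suc)                          ≡⟨ cong₂ _+_ (eq zero) (∑-linear _ _ _ t (eq ∘ suc)) ⟩
  (g zero + t * h zero) + (∑ (g ∘ suc) + t * ∑ (h ∘ suc))
    ≡⟨ regroup (g zero) (∑ (g ∘ suc)) (h zero) (∑ (h ∘ suc)) t ⟩
  ∑ g + t * ∑ h                                 ∎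
  where
  regroup : ∀ a b c d t → (a + t * c) + (b + t * d) ≡ (a + b) + t * (c + d)
  regroup = solve-∀

*-distribˡ-∑ : ∀ {n} (c : ℤ) (f : Fin n → ℤ) → c * ∑ f ≡ ∑ (λ i → c * f i)
*-distribˡ-∑ {zero}  c f = ℤ.*-zeroʳ c
*-distribˡ-∑ {suc n} c f =
  trans (ℤ.*-distribˡ-+ c (f zero) _) (cong (_+_ (c * f zero)) (*-distribˡ-∑ c (f ∘ suc)))

∑-punchIn : ∀ {n} (f : Fin (suc n) → ℤ) (c : Fin (suc n)) → ∑ f ≡ f c + ∑ (f ∘ punchIn c)
∑-punchIn         f zero    = refl
∑-punchIn {suc n} f (suc c) = begin
  f zero + ∑ (f ∘ suc)                           ≡⟨ cong (_+_ (f zero)) (∑-punchIn (f ∘ suc) c) ⟩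
  f zero + (f (suc c) + ∑ (f ∘ suc ∘ punchIn c)) ≡⟨ swap (f zero) (f (suc c)) _ ⟩
  f (suc c) + (f zero + ∑ (f ∘ suc ∘ punchIn c)) ∎
  where
  swap : ∀ a b c → a + (b + c) ≡ b + (a + c)
  swap = solve-∀

∑-pair : ∀ {n} (f : Fin (suc n) → ℤ) {a b : Fin (suc n)} → a ≢ b →
         (∀ j → j ≢ a → j ≢ b → f j ≡ + 0) → ∑ f ≡ f a + f b
∑-pair {zero}  f {zero} {zero} a≢b _ = ⊥-elim (a≢b refl)
∑-pair {suc n} f {a} {b} a≢b rest≡0 = begin
  ∑ f                                 ≡⟨ ∑-punchIn f a ⟩
  f a + ∑ (f ∘ punchIn a)             ≡⟨ cong (_+_ (f a)) (∑-punchIn (f ∘ punchIn a) b′) ⟩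
  f a + (f (punchIn a b′) + ∑ (f ∘ punchIn a ∘ punchIn b′))
    ≡⟨ cong₂ (λ x y → f a + (f x + y)) (punchIn-punchOut a≢b) (∑-zero rest) ⟩
  f a + (f b + + 0)                   ≡⟨ cong (_+_ (f a)) (ℤ.+-identityʳ (f b)) ⟩
  f a + f b                           ∎
  where
  b′ = punchOut a≢b
  rest : ∀ k → f (punchIn a (punchIn b′ k)) ≡ + 0
  rest k = rest≡0 _ (punchInᵢ≢i a _) λ eq →
    punchInᵢ≢i b′ k (punchIn-injective a _ _ (trans eq (sym (punchIn-punchOut a≢b))))

sign-suc : ∀ k → sign (suc k) ≡ - sign k
sign-suc zero          = refl
sign-suc (suc zero)    = refl
sign-suc (suc (suc k)) = sign-suc k

sign-+ : ∀ m n → sign (m ℕ.+ n) ≡ sign m * sign n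
sign-+ zero    n = sym (ℤ.*-identityˡ (sign n))
sign-+ (suc m) n = begin
  sign (suc (m ℕ.+ n))   ≡⟨ sign-suc (m ℕ.+ n) ⟩
  - sign (m ℕ.+ n)       ≡⟨ cong -_ (sign-+ m n) ⟩
  - (sign m * sign n)    ≡⟨ ℤ.neg-distribˡ-* (sign m) (sign n) ⟩
  - sign m * sign n      ≡⟨ cong (_* sign n) (sym (sign-suc m)) ⟩
  sign (suc m) * sign n  ∎

sign-double : ∀ k → sign (k ℕ.+ k) ≡ + 1
sign-double k = trans (sign-+ k k) (square k)
  where
  square : ∀ k → sign k * sign k ≡ + 1
  square zero          = refl
  square (suc zero)    = refl
  square (suc (suc k)) = square k

punchIn-inject₁-self : ∀ {n} (i : Fin n) → punchIn (inject₁ i) i ≡ suc i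
punchIn-inject₁-self zero    = refl
punchIn-inject₁-self (suc i) = cong suc (punchIn-inject₁-self i)

punchIn-suc-self : ∀ {n} (i : Fin n) → punchIn (suc i) i ≡ inject₁ i
punchIn-suc-self zero    = refl
punchIn-suc-self (suc i) = cong suc (punchIn-suc-self i)

punchIn-inject₁≡punchIn-suc : ∀ {n} (i k : Fin n) → k ≢ i → punchIn (inject₁ i) k ≡ punchIn (suc i) k
punchIn-inject₁≡punchIn-suc zero    zero    k≢i = ⊥-elim (k≢i refl)
punchIn-inject₁≡punchIn-suc zero    (suc k) k≢i = refl
punchIn-inject₁≡punchIn-suc (suc i) zero    k≢i = refl
punchIn-inject₁≡punchIn-suc (suc i) (suc k) k≢i =
  cong suc (punchIn-inject₁≡punchIn-suc i k (k≢i ∘ cong suc))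

punchIn-adjacent : ∀ {n} (i : Fin (suc n)) (j : Fin (suc (suc n))) → j ≢ inject₁ i → j ≢ suc i →
                   ∃ λ (i′ : Fin n) → punchIn j (inject₁ i′) ≡ inject₁ i × punchIn j (suc i′) ≡ suc i
punchIn-adjacent zero    zero          j≢a _   = ⊥-elim (j≢a refl)
punchIn-adjacent zero    (suc zero)    _   j≢b = ⊥-elim (j≢b refl)
punchIn-adjacent {suc n} zero (suc (suc j)) _ _ = zero , refl , refl
punchIn-adjacent (suc i) zero          _   _   = i , refl , refl
punchIn-adjacent {suc n} (suc i) (suc j) j≢a j≢b
  with i′ , p , q ← punchIn-adjacent i j (j≢a ∘ cong suc) (j≢b ∘ cong suc)
  = suc i′ , cong suc p , cong suc q

-- partner c j is the position of column c in the minor obtained by deleting column punchIn c j.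
partner : ∀ {n} → Fin (suc (suc n)) → Fin (suc n) → Fin (suc n)
partner zero    j               = zero
partner (suc c) zero            = c
partner {suc n} (suc c) (suc j) = suc (partner c j)

punchIn-partner : ∀ {n} (c : Fin (suc (suc n))) (j : Fin (suc n)) → punchIn (punchIn c j) (partner c j) ≡ c
punchIn-partner zero    j               = refl
punchIn-partner (suc c) zero            = refl
punchIn-partner {suc n} (suc c) (suc j) = cong suc (punchIn-partner c j)

punchIn-partner-punchIn : ∀ {n} (c : Fin (suc (suc n))) (j : Fin (suc n)) (k : Fin n) →
  punchIn (punchIn c j) (punchIn (partner c j) k) ≡ punchIn c (punchIn j k)
punchIn-partner-punchIn zero    j               k       = refl
punchIn-partner-punchIn (suc c) zero            k       = refl
punchIn-partner-punchIn {suc n} (suc c) (suc j) zero    = refl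
punchIn-partner-punchIn {suc n} (suc c) (suc j) (suc k) = cong suc (punchIn-partner-punchIn c j k)

sign-suc-+-suc : ∀ m n → sign (suc m ℕ.+ suc n) ≡ sign (m ℕ.+ n)
sign-suc-+-suc m n = cong (sign ∘ suc) (ℕ.+-suc m n)

sign-punchIn-partner : ∀ {n} (c : Fin (suc (suc n))) (j : Fin (suc n)) →
  sign (toℕ (punchIn c j) ℕ.+ toℕ (partner c j)) ≡ - sign (toℕ c ℕ.+ toℕ j)
sign-punchIn-partner zero j = begin
  sign (suc (toℕ j) ℕ.+ 0) ≡⟨ cong (sign ∘ suc) (ℕ.+-identityʳ (toℕ j)) ⟩
  sign (suc (toℕ j))        ≡⟨ sign-suc (toℕ j) ⟩
  - sign (toℕ j)            ∎
sign-punchIn-partner (suc c) zero = begin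
  sign (toℕ c)                  ≡⟨ sym (ℤ.neg-involutive (sign (toℕ c))) ⟩
  - - sign (toℕ c)              ≡⟨ cong -_ (sym (sign-suc (toℕ c))) ⟩
  - sign (suc (toℕ c))          ≡⟨ cong (λ m → - sign (suc m)) (sym (ℕ.+-identityʳ (toℕ c))) ⟩
  - sign (suc (toℕ c) ℕ.+ 0)    ∎
sign-punchIn-partner {suc n} (suc c) (suc j) = begin
  sign (suc (toℕ (punchIn c j)) ℕ.+ suc (toℕ (partner c j))) ≡⟨ sign-suc-+-suc (toℕ (punchIn c j)) _ ⟩
  sign (toℕ (punchIn c j) ℕ.+ toℕ (partner c j))             ≡⟨ sign-punchIn-partner c j ⟩
  - sign (toℕ c ℕ.+ toℕ j)                                   ≡⟨ cong -_ (sym (sign-suc-+-suc (toℕ c) _)) ⟩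
  - sign (suc (toℕ c) ℕ.+ suc (toℕ j))                       ∎

sign-reindex : ∀ {n} (r : ℕ) (c : Fin (suc (suc n))) (j : Fin (suc n)) →
  sign (toℕ (punchIn c j)) * sign (r ℕ.+ toℕ (partner c j)) ≡ sign (suc r ℕ.+ toℕ c) * sign (toℕ j)
sign-reindex r c j = begin
  sign J * sign (r ℕ.+ K)              ≡⟨ sym (sign-+ J (r ℕ.+ K)) ⟩
  sign (J ℕ.+ (r ℕ.+ K))               ≡⟨ cong sign (exchange J r K) ⟩
  sign (r ℕ.+ (J ℕ.+ K))               ≡⟨ sign-+ r (J ℕ.+ K) ⟩
  sign r * sign (J ℕ.+ K)              ≡⟨ cong (sign r *_) (sign-punchIn-partner c j) ⟩
  sign r * - sign (toℕ c ℕ.+ toℕ j)    ≡⟨ sym (ℤ.neg-distribʳ-* (sign r) _) ⟩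
  - (sign r * sign (toℕ c ℕ.+ toℕ j))  ≡⟨ cong -_ (sym (sign-+ r _)) ⟩
  - sign (r ℕ.+ (toℕ c ℕ.+ toℕ j))     ≡⟨ sym (sign-suc (r ℕ.+ (toℕ c ℕ.+ toℕ j))) ⟩
  sign (suc (r ℕ.+ (toℕ c ℕ.+ toℕ j))) ≡⟨ cong (sign ∘ suc) (sym (ℕ.+-assoc r (toℕ c) (toℕ j))) ⟩
  sign (suc r ℕ.+ toℕ c ℕ.+ toℕ j)     ≡⟨ sign-+ (suc r ℕ.+ toℕ c) (toℕ j) ⟩
  sign (suc r ℕ.+ toℕ c) * sign (toℕ j) ∎
  where
  J = toℕ (punchIn c j)
  K = toℕ (partner c j)
  exchange : ∀ a b c → a ℕ.+ (b ℕ.+ c) ≡ b ℕ.+ (a ℕ.+ c)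
  exchange = ℕ-Solver.solve-∀

minor : ∀ {n} → Mat (suc n) → Fin (suc n) → Mat n
minor M j x k = M (suc x) (punchIn j k)

cofactorTerm : ∀ {n} → Mat (suc n) → Fin (suc n) → ℤ
cofactorTerm M j = sign (toℕ j) * (M zero j * det (minor M j))

det-cong : ∀ {n} {M N : Mat n} → (∀ x y → M x y ≡ N x y) → det M ≡ det N
det-cong {zero}  M≗N = refl
det-cong {suc n} M≗N = ∑-cong λ j →
  cong₂ (λ m d → sign (toℕ j) * (m * d)) (M≗N zero j) (det-cong λ x k → M≗N (suc x) (punchIn j k))

cofactorTerm-linear-entry : ∀ {n} (M A B : Mat (suc n)) (t : ℤ) j →
  M zero j ≡ A zero j + t * B zero j → det (minor M j) ≡ det (minor A j) → det (minor M j) ≡ det (minor B j) →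
  cofactorTerm M j ≡ cofactorTerm A j + t * cofactorTerm B j
cofactorTerm-linear-entry M A B t j entry minorA minorB = begin
  s * (M zero j * d)                            ≡⟨ cong (λ m → s * (m * d)) entry ⟩
  s * ((A zero j + t * B zero j) * d)           ≡⟨ distrib s (A zero j) (B zero j) t d ⟩
  s * (A zero j * d) + t * (s * (B zero j * d))
    ≡⟨ cong₂ (λ dA dB → s * (A zero j * dA) + t * (s * (B zero j * dB))) minorA minorB ⟩
  cofactorTerm A j + t * cofactorTerm B j       ∎
  where
  s = sign (toℕ j)
  d = det (minor M j)
  distrib : ∀ s a b t d → s * ((a + t * b) * d) ≡ s * (a * d) + t * (s * (b * d))
  distrib = solve-∀

cofactorTerm-linear-minor : ∀ {n} (M A B : Mat (suc n)) (t : ℤ) j →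
  M zero j ≡ A zero j → M zero j ≡ B zero j → det (minor M j) ≡ det (minor A j) + t * det (minor B j) →
  cofactorTerm M j ≡ cofactorTerm A j + t * cofactorTerm B j
cofactorTerm-linear-minor M A B t j entryA entryB minor-linear = begin
  s * (m * det (minor M j))                               ≡⟨ cong (λ d → s * (m * d)) minor-linear ⟩
  s * (m * (det (minor A j) + t * det (minor B j)))       ≡⟨ distrib s m t (det (minor A j)) (det (minor B j)) ⟩
  s * (m * det (minor A j)) + t * (s * (m * det (minor B j)))
    ≡⟨ cong₂ (λ a b → s * (a * det (minor A j)) + t * (s * (b * det (minor B j)))) entryA entryB ⟩
  cofactorTerm A j + t * cofactorTerm B j                 ∎
  where
  s = sign (toℕ j)
  m = M zero j
  distrib : ∀ s m t a b → s * (m * (a + t * b)) ≡ s * (m * a) + t * (s * (m * b))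
  distrib = solve-∀

det-linear-column : ∀ {n} (c : Fin n) (M A B : Mat n) (t : ℤ) →
  (∀ x y → y ≢ c → M x y ≡ A x y) → (∀ x y → y ≢ c → M x y ≡ B x y) →
  (∀ x → M x c ≡ A x c + t * B x c) → det M ≡ det A + t * det B
det-linear-column {suc n} c M A B t M≈A M≈B M≡A+tB = ∑-linear _ (cofactorTerm A) (cofactorTerm B) t term
  where
  term : ∀ j → cofactorTerm M j ≡ cofactorTerm A j + t * cofactorTerm B j
  term j with j Fin.≟ c
  ... | yes refl = cofactorTerm-linear-entry M A B t j (M≡A+tB zero)
                     (det-cong λ x k → M≈A _ _ (punchInᵢ≢i j k)) (det-cong λ x k → M≈B _ _ (punchInᵢ≢i j k))
  ... | no j≢c = cofactorTerm-linear-minor M A B t j (M≈A zero j j≢c) (M≈B zero j j≢c)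
                   (det-linear-column c′ (minor M j) (minor A j) (minor B j) t
                     (λ x k k≢c′ → M≈A _ _ (avoids-c k k≢c′)) (λ x k k≢c′ → M≈B _ _ (avoids-c k k≢c′))
                     λ x → subst (λ y → M (suc x) y ≡ A (suc x) y + t * B (suc x) y)
                                 (sym (punchIn-punchOut j≢c)) (M≡A+tB (suc x)))
    where
    c′ = punchOut j≢c
    avoids-c : ∀ k → k ≢ c′ → punchIn j k ≢ c
    avoids-c k k≢c′ eq = k≢c′ (punchIn-injective j k c′ (trans eq (sym (punchIn-punchOut j≢c))))

det-linear-row : ∀ {n} (r : Fin n) (M A B : Mat n) (t : ℤ) →
  (∀ x y → x ≢ r → M x y ≡ A x y) → (∀ x y → x ≢ r → M x y ≡ B x y) →
  (∀ y → M r y ≡ A r y + t * B r y) → det M ≡ det A + t * det B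
det-linear-row {suc n} zero M A B t M≈A M≈B M≡A+tB = ∑-linear _ (cofactorTerm A) (cofactorTerm B) t λ j →
  cofactorTerm-linear-entry M A B t j (M≡A+tB j)
    (det-cong λ x k → M≈A (suc x) (punchIn j k) λ ()) (det-cong λ x k → M≈B (suc x) (punchIn j k) λ ())
det-linear-row {suc n} (suc r) M A B t M≈A M≈B M≡A+tB = ∑-linear _ (cofactorTerm A) (cofactorTerm B) t λ j →
  cofactorTerm-linear-minor M A B t j (M≈A zero j λ ()) (M≈B zero j λ ())
    (det-linear-row r (minor M j) (minor A j) (minor B j) t
      (λ x k x≢r → M≈A _ _ (x≢r ∘ suc-injective)) (λ x k x≢r → M≈B _ _ (x≢r ∘ suc-injective))
      λ k → M≡A+tB (punchIn j k))

cofactorTerm-minor≡0 : ∀ {n} (M : Mat (suc n)) j → det (minor M j) ≡ + 0 → cofactorTerm M j ≡ + 0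
cofactorTerm-minor≡0 M j minor≡0 = begin
  sign (toℕ j) * (M zero j * det (minor M j)) ≡⟨ cong (λ d → sign (toℕ j) * (M zero j * d)) minor≡0 ⟩
  sign (toℕ j) * (M zero j * + 0)             ≡⟨ cong (sign (toℕ j) *_) (ℤ.*-zeroʳ (M zero j)) ⟩
  sign (toℕ j) * + 0                          ≡⟨ ℤ.*-zeroʳ (sign (toℕ j)) ⟩
  + 0                                         ∎

cofactorTerm-entry≡0 : ∀ {n} (M : Mat (suc n)) j → M zero j ≡ + 0 → cofactorTerm M j ≡ + 0
cofactorTerm-entry≡0 M j entry≡0 = begin
  sign (toℕ j) * (M zero j * det (minor M j)) ≡⟨ cong (λ m → sign (toℕ j) * (m * det (minor M j))) entry≡0 ⟩
  sign (toℕ j) * (+ 0 * det (minor M j))      ≡⟨ cong (sign (toℕ j) *_) (ℤ.*-zeroˡ (det (minor M j))) ⟩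
  sign (toℕ j) * + 0                          ≡⟨ ℤ.*-zeroʳ (sign (toℕ j)) ⟩
  + 0                                         ∎

det-zero-column : ∀ {n} (M : Mat n) (c : Fin n) → (∀ x → M x c ≡ + 0) → det M ≡ + 0
det-zero-column {suc n} M c column≡0 = ∑-zero term
  where
  term : ∀ j → cofactorTerm M j ≡ + 0
  term j with j Fin.≟ c
  ... | yes refl = cofactorTerm-entry≡0 M j (column≡0 zero)
  ... | no j≢c   = cofactorTerm-minor≡0 M j (det-zero-column (minor M j) (punchOut j≢c) λ x →
                     trans (cong (M (suc x)) (punchIn-punchOut j≢c)) (column≡0 (suc x)))

det-adjacent-columns : ∀ {n} (M : Mat (suc n)) (i : Fin n) →
  (∀ x → M x (inject₁ i) ≡ M x (suc i)) → det M ≡ + 0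
det-adjacent-columns {suc n} M i columns≡ = begin
  det M                                               ≡⟨ ∑-pair (cofactorTerm M) a≢b others ⟩
  cofactorTerm M (inject₁ i) + cofactorTerm M (suc i) ≡⟨ cancel ⟩
  + 0                                                 ∎
  where
  a≢b : inject₁ i ≢ suc i
  a≢b eq = ℕ.<⇒≢ (ℕ.n<1+n (toℕ i)) (trans (sym (toℕ-inject₁ i)) (cong toℕ eq))
  others : ∀ j → j ≢ inject₁ i → j ≢ suc i → cofactorTerm M j ≡ + 0
  others j j≢a j≢b with i′ , pa , pb ← punchIn-adjacent i j j≢a j≢b =
    cofactorTerm-minor≡0 M j (det-adjacent-columns (minor M j) i′ λ x →
      trans (cong (M (suc x)) pa) (trans (columns≡ (suc x)) (cong (M (suc x)) (sym pb))))
  minors≡ : ∀ x k → minor M (suc i) x k ≡ minor M (inject₁ i) x k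
  minors≡ x k with k Fin.≟ i
  ... | yes refl = trans (cong (M (suc x)) (punchIn-suc-self k))
                   (trans (columns≡ (suc x)) (cong (M (suc x)) (sym (punchIn-inject₁-self k))))
  ... | no k≢i = cong (M (suc x)) (sym (punchIn-inject₁≡punchIn-suc i k k≢i))
  sign-b : sign (toℕ (suc i)) ≡ - sign (toℕ (inject₁ i))
  sign-b = trans (sign-suc (toℕ i)) (cong (-_ ∘ sign) (sym (toℕ-inject₁ i)))
  cancel : cofactorTerm M (inject₁ i) + cofactorTerm M (suc i) ≡ + 0
  cancel = begin
    s * (m * d) + sign (toℕ (suc i)) * (M zero (suc i) * det (minor M (suc i)))
      ≡⟨ cong₂ (λ s′ m′ → s * (m * d) + s′ * (m′ * det (minor M (suc i)))) sign-b (sym (columns≡ zero)) ⟩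
    s * (m * d) + - s * (m * det (minor M (suc i))) ≡⟨ cong (λ d′ → s * (m * d) + - s * (m * d′)) (det-cong minors≡) ⟩
    s * (m * d) + - s * (m * d)                     ≡⟨ cong (_+_ (s * (m * d))) (sym (ℤ.neg-distribˡ-* s (m * d))) ⟩
    s * (m * d) + - (s * (m * d))                   ≡⟨ ℤ.+-inverseʳ (s * (m * d)) ⟩
    + 0                                             ∎
    where
    s = sign (toℕ (inject₁ i))
    m = M zero (inject₁ i)
    d = det (minor M (inject₁ i))

det-unit-column : ∀ {n} (M : Mat (suc n)) (r c : Fin (suc n)) →
  M r c ≡ + 1 → (∀ x → x ≢ r → M x c ≡ + 0) →
  det M ≡ sign (toℕ r ℕ.+ toℕ c) * det (λ x k → M (punchIn r x) (punchIn c k))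
det-unit-column {zero} M zero zero one _ = cong (λ m → + 1 * (m * + 1) + + 0) one
det-unit-column {suc n} M zero c one zeros = begin
  det M                                                       ≡⟨ ∑-punchIn (cofactorTerm M) c ⟩
  cofactorTerm M c + ∑ (cofactorTerm M ∘ punchIn c)
    ≡⟨ cong₂ _+_ (cong (λ m → sign (toℕ c) * (m * det (minor M c))) one) (∑-zero others) ⟩
  sign (toℕ c) * (+ 1 * det (minor M c)) + + 0                ≡⟨ ℤ.+-identityʳ _ ⟩
  sign (toℕ c) * (+ 1 * det (minor M c))                      ≡⟨ cong (sign (toℕ c) *_) (ℤ.*-identityˡ _) ⟩
  sign (toℕ c) * det (minor M c)                              ∎
  where
  others : ∀ j → cofactorTerm M (punchIn c j) ≡ + 0
  others j = cofactorTerm-minor≡0 M (punchIn c j) (det-zero-column (minor M (punchIn c j)) (partner c j) λ x →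
    trans (cong (M (suc x)) (punchIn-partner c j)) (zeros (suc x) λ ()))
det-unit-column {suc n} M (suc r) c one zeros = begin
  det M                                                    ≡⟨ ∑-punchIn (cofactorTerm M) c ⟩
  cofactorTerm M c + ∑ (cofactorTerm M ∘ punchIn c)
    ≡⟨ cong₂ _+_ (cofactorTerm-entry≡0 M c (zeros zero λ ())) (∑-cong term) ⟩
  + 0 + ∑ (λ j → σ * (sign (toℕ j) * (M zero (punchIn c j) * E j))) ≡⟨ ℤ.+-identityˡ _ ⟩
  ∑ (λ j → σ * (sign (toℕ j) * (M zero (punchIn c j) * E j)))
    ≡⟨ sym (*-distribˡ-∑ σ λ j → sign (toℕ j) * (M zero (punchIn c j) * E j)) ⟩
  σ * det (λ x k → M (punchIn (suc r) x) (punchIn c k))   ∎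
  where
  σ = sign (suc (toℕ r) ℕ.+ toℕ c)
  E : Fin (suc n) → ℤ
  E j = det (λ x k → M (suc (punchIn r x)) (punchIn c (punchIn j k)))
  regroup : ∀ a b σ s m e → a * b ≡ σ * s → a * (m * (b * e)) ≡ σ * (s * (m * e))
  regroup a b σ s m e ab≡σs = begin
    a * (m * (b * e)) ≡⟨ assoc₁ a b m e ⟩
    (a * b) * (m * e) ≡⟨ cong (_* (m * e)) ab≡σs ⟩
    (σ * s) * (m * e) ≡⟨ ℤ.*-assoc σ s (m * e) ⟩
    σ * (s * (m * e)) ∎
    where
    assoc₁ : ∀ a b m e → a * (m * (b * e)) ≡ (a * b) * (m * e)
    assoc₁ = solve-∀
  term : ∀ j → cofactorTerm M (punchIn c j) ≡ σ * (sign (toℕ j) * (M zero (punchIn c j) * E j))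
  term j = trans (cong (λ d → sign (toℕ J) * (M zero J * d)) minor-expansion)
                 (regroup (sign (toℕ J)) (sign (toℕ r ℕ.+ toℕ K)) σ (sign (toℕ j)) (M zero J) (E j)
                          (sign-reindex (toℕ r) c j))
    where
    J = punchIn c j
    K = partner c j
    minor-expansion : det (minor M J) ≡ sign (toℕ r ℕ.+ toℕ K) * E j
    minor-expansion = trans
      (det-unit-column (minor M J) r K (trans (cong (M (suc r)) (punchIn-partner c j)) one)
        λ x x≢r → trans (cong (M (suc x)) (punchIn-partner c j)) (zeros (suc x) (x≢r ∘ suc-injective)))
      (cong (sign (toℕ r ℕ.+ toℕ K) *_) (det-cong λ x k → cong (M (suc (punchIn r x))) (punchIn-partner-punchIn c j k)))

eqFin-refl : ∀ {n} (x : Fin n) → eqFin x x ≡ true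
eqFin-refl zero    = refl
eqFin-refl (suc x) = eqFin-refl x

eqFin-≢ : ∀ {n} {x y : Fin n} → x ≢ y → eqFin x y ≡ false
eqFin-≢ {x = zero}  {zero}  x≢y = ⊥-elim (x≢y refl)
eqFin-≢ {x = zero}  {suc y} x≢y = refl
eqFin-≢ {x = suc x} {zero}  x≢y = refl
eqFin-≢ {x = suc x} {suc y} x≢y = eqFin-≢ (x≢y ∘ cong suc)

δ : ∀ {n} → Fin n → Fin n → ℤ
δ x y = b2z (eqFin x y)

δ-refl : ∀ {n} (x : Fin n) → δ x x ≡ + 1
δ-refl x = cong b2z (eqFin-refl x)

δ-≢ : ∀ {n} {x y : Fin n} → x ≢ y → δ x y ≡ + 0
δ-≢ x≢y = cong b2z (eqFin-≢ x≢y)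

withColumn : ∀ {n} → Mat n → Fin n → (Fin n → ℤ) → Mat n
withColumn M c v x y = if eqFin y c then v x else M x y

withColumn-≡ : ∀ {n} (M : Mat n) c v x → withColumn M c v x c ≡ v x
withColumn-≡ M c v x = cong (if_then v x else M x c) (eqFin-refl c)

withColumn-≢ : ∀ {n} (M : Mat n) {c y} v x → y ≢ c → withColumn M c v x y ≡ M x y
withColumn-≢ M v x y≢c = cong (if_then v x else M x _) (eqFin-≢ y≢c)

det-withColumn-unit : ∀ {n} (M : Mat (suc n)) (r c : Fin (suc n)) →
  det (withColumn M c (λ x → δ x r)) ≡ sign (toℕ r ℕ.+ toℕ c) * det (λ x k → M (punchIn r x) (punchIn c k))
det-withColumn-unit M r c = trans
  (det-unit-column (withColumn M c e) r c (trans (withColumn-≡ M c e r) (δ-refl r))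
    λ x x≢r → trans (withColumn-≡ M c e x) (δ-≢ x≢r))
  (cong (sign (toℕ r ℕ.+ toℕ c) *_) (det-cong λ x k → withColumn-≢ M e (punchIn r x) (punchInᵢ≢i c k)))
  where
  e : Fin _ → ℤ
  e x = δ x r

det-adjacent-column-difference : ∀ {n} (M : Mat (suc n)) (i : Fin n) (d : ℤ) →
  (∀ x → M x (inject₁ i) ≡ M x (suc i) + d * (δ x (inject₁ i) - δ x (suc i))) →
  det M ≡ d * (det (λ x k → M (punchIn (inject₁ i) x) (punchIn (inject₁ i) k))
               + det (λ x k → M (punchIn (suc i) x) (punchIn (inject₁ i) k)))
det-adjacent-column-difference M i d columns = begin
  det M                                                              ≡⟨ split-column ⟩
  det colB + d * det colΔ                                            ≡⟨ cong₂ (λ p q → p + d * q) colB≡0 split-unit ⟩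
  + 0 + d * (det (unitColumn a) + - + 1 * det (unitColumn b))        ≡⟨ cong₂ (λ p q → + 0 + d * (p + - + 1 * q)) unit-a unit-b ⟩
  + 0 + d * (det Maa + - + 1 * - det Mba)                            ≡⟨ arrange d (det Maa) (det Mba) ⟩
  d * (det Maa + det Mba)                                            ∎
  where
  a = inject₁ i
  b = suc i
  Maa Mba : Mat _
  Maa x k = M (punchIn a x) (punchIn a k)
  Mba x k = M (punchIn b x) (punchIn a k)
  unitColumn : Fin _ → Mat _
  unitColumn r = withColumn M a (λ x → δ x r)
  colB colΔ : Mat _
  colB = withColumn M a (λ x → M x b)
  colΔ = withColumn M a (λ x → δ x a - δ x b)
  arrange : ∀ d x y → + 0 + d * (x + - + 1 * - y) ≡ d * (x + y)
  arrange = solve-∀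
  split-column : det M ≡ det colB + d * det colΔ
  split-column = det-linear-column a M colB colΔ d
    (λ x y y≢a → sym (withColumn-≢ M (λ x → M x b) x y≢a))
    (λ x y y≢a → sym (withColumn-≢ M (λ x → δ x a - δ x b) x y≢a))
    λ x → trans (columns x)
      (sym (cong₂ (λ p q → p + d * q) (withColumn-≡ M a (λ x → M x b) x) (withColumn-≡ M a (λ x → δ x a - δ x b) x)))
  colB≡0 : det colB ≡ + 0
  colB≡0 = det-adjacent-columns colB i λ x →
    trans (withColumn-≡ M a (λ x → M x b) x) (sym (withColumn-≢ M (λ x → M x b) x b≢a))
    where
    b≢a : b ≢ a
    b≢a eq = ℕ.<⇒≢ (ℕ.n<1+n (toℕ i)) (trans (sym (toℕ-inject₁ i)) (cong toℕ (sym eq)))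
  split-unit : det colΔ ≡ det (unitColumn a) + - + 1 * det (unitColumn b)
  split-unit = det-linear-column a colΔ (unitColumn a) (unitColumn b) (- + 1)
    (λ x y y≢a → trans (withColumn-≢ M (λ x → δ x a - δ x b) x y≢a) (sym (withColumn-≢ M (λ x → δ x a) x y≢a)))
    (λ x y y≢a → trans (withColumn-≢ M (λ x → δ x a - δ x b) x y≢a) (sym (withColumn-≢ M (λ x → δ x b) x y≢a)))
    λ x → trans (withColumn-≡ M a (λ x → δ x a - δ x b) x)
            (trans (minus (δ x a) (δ x b))
              (sym (cong₂ (λ p q → p + - + 1 * q) (withColumn-≡ M a (λ x → δ x a) x) (withColumn-≡ M a (λ x → δ x b) x))))
    where
    minus : ∀ p q → p - q ≡ p + - + 1 * q
    minus = solve-∀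
  unit-a : det (unitColumn a) ≡ det Maa
  unit-a = trans (det-withColumn-unit M a a) (trans (cong (_* det Maa) (sign-double (toℕ a))) (ℤ.*-identityˡ (det Maa)))
  unit-b : det (unitColumn b) ≡ - det Mba
  unit-b = trans (det-withColumn-unit M b a) (trans (cong (_* det Mba) sign-ba) (ℤ.-1*i≡-i (det Mba)))
    where
    sign-ba : sign (suc (toℕ i) ℕ.+ toℕ a) ≡ - + 1
    sign-ba = trans (sign-suc (toℕ i ℕ.+ toℕ a))
                    (cong -_ (trans (cong (λ m → sign (m ℕ.+ toℕ a)) (sym (toℕ-inject₁ i))) (sign-double (toℕ a))))

-- M′ is M with row inject₁ i added to row suc i, then row and column inject₁ i deleted.
det-merge-adjacent : ∀ {n} (M : Mat (suc n)) (i : Fin n) (d : ℤ) (M′ : Mat n) →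
  (∀ x → M x (inject₁ i) ≡ M x (suc i) + d * (δ x (inject₁ i) - δ x (suc i))) →
  (∀ x k → M′ x k ≡ M (punchIn (inject₁ i) x) (punchIn (inject₁ i) k) + δ x i * M (inject₁ i) (punchIn (inject₁ i) k)) →
  det M ≡ d * det M′
det-merge-adjacent M i d M′ columns rows = begin
  det M                    ≡⟨ det-adjacent-column-difference M i d columns ⟩
  d * (det Maa + det Mba)  ≡⟨ cong (λ y → d * (det Maa + y)) (sym (ℤ.*-identityˡ (det Mba))) ⟩
  d * (det Maa + + 1 * det Mba) ≡⟨ cong (d *_) (sym merged) ⟩
  d * det M′               ∎
  where
  a = inject₁ i
  Maa Mba : Mat _
  Maa x k = M (punchIn a x) (punchIn a k)
  Mba x k = M (punchIn (suc i) x) (punchIn a k)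
  rows-off : ∀ x k → x ≢ i → M′ x k ≡ Maa x k
  rows-off x k x≢i = trans (rows x k)
    (trans (cong (λ e → Maa x k + e * M a (punchIn a k)) (δ-≢ x≢i)) (ℤ.+-identityʳ (Maa x k)))
  merged : det M′ ≡ det Maa + + 1 * det Mba
  merged = det-linear-row i M′ Maa Mba (+ 1) rows-off
    (λ x k x≢i → trans (rows-off x k x≢i) (cong (λ y → M y (punchIn a k)) (punchIn-inject₁≡punchIn-suc i x x≢i)))
    λ k → trans (rows i k) (cong₂ (λ e y → Maa i k + e * M y (punchIn a k)) (δ-refl i) (sym (punchIn-suc-self i)))

∑ᴾ : ∀ {k n} → (Fin n → Polynomial k) → Polynomial k
∑ᴾ {n = zero}  f = con (+ 0)
∑ᴾ {n = suc n} f = f zero :+ ∑ᴾ (f ∘ suc)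

-- `det` transcribed into ring-solver syntax: for a concrete size, ⟦ detᴾ E ⟧ ρ unfolds to the
-- same term as `det` of the evaluated entries, so `prove` can normalise a symbolic determinant.
detᴾ : ∀ {k n} → (Fin n → Fin n → Polynomial k) → Polynomial k
detᴾ {n = zero}  E = con (+ 1)
detᴾ {n = suc n} E = ∑ᴾ λ j → con (sign (toℕ j)) :* (E zero j :* detᴾ (λ x y → E (suc x) (punchIn j y)))

-- Vertex families are sequences ℕ → A, so that matrices of every size can read the same family.
infixr 5 _∷ˢ_ _++ˢ_

_∷ˢ_ : ∀ {A : Set} → A → (ℕ → A) → ℕ → A
(x ∷ˢ f) zero    = x
(x ∷ˢ f) (suc j) = f j

_++ˢ_ : ∀ {A : Set} → List A → (ℕ → A) → ℕ → A
[]       ++ˢ f = f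
(x ∷ xs) ++ˢ f = x ∷ˢ (xs ++ˢ f)

module _ {A : Set} where

  ++ˢ-length : ∀ (xs : List A) y (g : ℕ → A) → (xs ++ˢ y ∷ˢ g) (length xs) ≡ y
  ++ˢ-length []       y g = refl
  ++ˢ-length (x ∷ xs) y g = ++ˢ-length xs y g

  ++ˢ-suc-length : ∀ (xs : List A) y y′ (g : ℕ → A) → (xs ++ˢ y ∷ˢ y′ ∷ˢ g) (suc (length xs)) ≡ y′
  ++ˢ-suc-length []       y y′ g = refl
  ++ˢ-suc-length (x ∷ xs) y y′ g = ++ˢ-suc-length xs y y′ g

  ++ˢ-punchIn : ∀ {n} (xs : List A) y y′ y″ (g : ℕ → A) (i : Fin n) → toℕ i ≡ length xs →
    ∀ x → x ≢ i → (xs ++ˢ y ∷ˢ y′ ∷ˢ g) (toℕ (punchIn (inject₁ i) x)) ≡ (xs ++ˢ y″ ∷ˢ g) (toℕ x)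
  ++ˢ-punchIn []       y y′ y″ g zero    _  zero    x≢i = ⊥-elim (x≢i refl)
  ++ˢ-punchIn []       y y′ y″ g zero    _  (suc x) x≢i = refl
  ++ˢ-punchIn (z ∷ xs) y y′ y″ g (suc i) _  zero    x≢i = refl
  ++ˢ-punchIn (z ∷ xs) y y′ y″ g (suc i) i≡ (suc x) x≢i =
    ++ˢ-punchIn xs y y′ y″ g i (ℕ.suc-injective i≡) x (x≢i ∘ cong suc)

replicate-++ˢ-const : ∀ {A : Set} k (x : A) j → (replicate k x ++ˢ λ _ → x) j ≡ x
replicate-++ˢ-const zero    x j       = refl
replicate-++ˢ-const (suc k) x zero    = refl
replicate-++ˢ-const (suc k) x (suc j) = replicate-++ˢ-const k x j

+-<ᵇ-cancelˡ : ∀ k m n → (k ℕ.+ m <ᵇ k ℕ.+ n) ≡ (m <ᵇ n)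
+-<ᵇ-cancelˡ zero    m n = refl
+-<ᵇ-cancelˡ (suc k) m n = +-<ᵇ-cancelˡ k m n

if-<ᵇ-replicate : ∀ {A B : Set} (φ : A → B) k (x : A) (g : ℕ → A) (h : ℕ → B) →
  (∀ j → φ (g (k ℕ.+ j)) ≡ h j) → ∀ j → φ (if j <ᵇ k then x else g j) ≡ (replicate k (φ x) ++ˢ h) j
if-<ᵇ-replicate φ zero    x g h g≗h j       = g≗h j
if-<ᵇ-replicate φ (suc k) x g h g≗h zero    = refl
if-<ᵇ-replicate φ (suc k) x g h g≗h (suc j) = if-<ᵇ-replicate φ k x (g ∘ suc) h g≗h j

∑-replicate-++ˢ : ∀ {A : Set} (h : A → ℤ) k {n} x (g : ℕ → A) →
  ∑ {k ℕ.+ n} (λ v → h ((replicate k x ++ˢ g) (toℕ v))) ≡ + k * h x + ∑ {n} (λ v → h (g (toℕ v)))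
∑-replicate-++ˢ h zero {n} x g =
  sym (trans (cong (_+ ∑ {n} (λ v → h (g (toℕ v)))) (ℤ.*-zeroˡ (h x))) (ℤ.+-identityˡ _))
∑-replicate-++ˢ h (suc k) x g = trans (cong (_+_ (h x)) (∑-replicate-++ˢ h k x g)) (regroup (h x) (+ k) _)
  where
  regroup : ∀ a k s → a + (k * a + s) ≡ (+ 1 + k) * a + s
  regroup = solve-∀

∑-resize : ∀ {m n} (F : ℕ → ℤ) → m ≡ n → ∑ {m} (F ∘ toℕ) ≡ ∑ {n} (F ∘ toℕ)
∑-resize F refl = refl

eqFin-punchIn : ∀ {n} (a : Fin (suc n)) (x y : Fin n) → eqFin (punchIn a x) (punchIn a y) ≡ eqFin x y
eqFin-punchIn zero    x       y       = refl
eqFin-punchIn (suc a) zero    zero    = refl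
eqFin-punchIn (suc a) zero    (suc y) = refl
eqFin-punchIn (suc a) (suc x) zero    = refl
eqFin-punchIn (suc a) (suc x) (suc y) = eqFin-punchIn a x y

δ-*-cong : ∀ {n} (F : Fin n → ℤ) x y → δ x y * F x ≡ δ x y * F y
δ-*-cong F x y with x Fin.≟ y
... | yes refl = refl
... | no x≢y   = trans (cong (_* F x) (δ-≢ x≢y)) (sym (cong (_* F y) (δ-≢ x≢y)))

-- The vertex with index j has type proj₁ (f j) and weight proj₂ (f j); the weight scales its row.
module TypeMatrix {τ : Set} (B : τ → τ → ℤ) (D : τ → ℤ) where

  typeEntry : τ × ℤ → τ → ℤ → ℤ
  typeEntry c t′ e = proj₂ c * B (proj₁ c) t′ + e * D (proj₁ c)

  typeMatrix : ∀ {n} → (ℕ → τ × ℤ) → Mat n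
  typeMatrix f u v = typeEntry (f (toℕ u)) (proj₁ (f (toℕ v))) (δ u v)

  det-typeMatrix-cong : ∀ {n} {f g : ℕ → τ × ℤ} → (∀ j → f j ≡ g j) → det (typeMatrix {n} f) ≡ det (typeMatrix {n} g)
  det-typeMatrix-cong {n} {f} {g} f≗g = det-cong {n} λ u v →
    cong₂ (λ fu fv → typeEntry fu (proj₁ fv) (δ u v)) (f≗g (toℕ u)) (f≗g (toℕ v))

  det-typeMatrix-resize : ∀ {m n} (f : ℕ → τ × ℤ) → m ≡ n → det (typeMatrix {m} f) ≡ det (typeMatrix {n} f)
  det-typeMatrix-resize f refl = refl

  private
    module Merge {n} (xs : List (τ × ℤ)) (t : τ) (w v : ℤ) (f : ℕ → τ × ℤ) (L<n : length xs ℕ.< n) where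
      orig merged : ℕ → τ × ℤ
      orig   = xs ++ˢ (t , w) ∷ˢ (t , v) ∷ˢ f
      merged = xs ++ˢ (t , w + v) ∷ˢ f
      M : Mat (suc n)
      M = typeMatrix orig
      M′ : Mat n
      M′ = typeMatrix merged
      i : Fin n
      i = fromℕ< L<n
      a : Fin (suc n)
      a = inject₁ i
      T : Fin (suc n) → τ
      W : Fin (suc n) → ℤ
      T x = proj₁ (orig (toℕ x))
      W x = proj₂ (orig (toℕ x))
      T′ : Fin n → τ
      T′ x = proj₁ (merged (toℕ x))
      toℕ-i : toℕ i ≡ length xs
      toℕ-i = toℕ-fromℕ< L<n
      orig-a : orig (toℕ a) ≡ (t , w)
      orig-a = trans (cong orig (trans (toℕ-inject₁ i) toℕ-i)) (++ˢ-length xs (t , w) ((t , v) ∷ˢ f))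
      orig-b : orig (toℕ (punchIn a i)) ≡ (t , v)
      orig-b = trans (cong (orig ∘ toℕ) (punchIn-inject₁-self i))
                     (trans (cong (orig ∘ suc) toℕ-i) (++ˢ-suc-length xs (t , w) (t , v) f))
      merged-i : merged (toℕ i) ≡ (t , w + v)
      merged-i = trans (cong merged toℕ-i) (++ˢ-length xs (t , w + v) f)
      merged-≢i : ∀ x → x ≢ i → merged (toℕ x) ≡ orig (toℕ (punchIn a x))
      merged-≢i x x≢i = sym (++ˢ-punchIn xs (t , w) (t , v) (t , w + v) f i toℕ-i x x≢i)
      T′≡T : ∀ x → T′ x ≡ T (punchIn a x)
      T′≡T x with x Fin.≟ i
      ... | yes refl = trans (cong proj₁ merged-i) (sym (cong proj₁ orig-b))
      ... | no x≢i   = cong proj₁ (merged-≢i x x≢i)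
      column : ∀ x c → T c ≡ t → M x c ≡ W x * B (T x) t + δ x c * D t
      column x c Tc≡t = cong₂ _+_ (cong (λ t′ → W x * B (T x) t′) Tc≡t)
                                  (trans (δ-*-cong (D ∘ T) x c) (cong (λ t′ → δ x c * D t′) Tc≡t))
      columns : ∀ x → M x a ≡ M x (suc i) + D t * (δ x a - δ x (suc i))
      columns x = begin
        M x a                                                     ≡⟨ column x a (cong proj₁ orig-a) ⟩
        W x * B (T x) t + δ x a * D t                             ≡⟨ shift (W x * B (T x) t) (δ x a) (δ x (suc i)) (D t) ⟩
        (W x * B (T x) t + δ x (suc i) * D t) + D t * (δ x a - δ x (suc i))
          ≡⟨ cong (λ m → m + D t * (δ x a - δ x (suc i))) (sym (column x (suc i) Tb≡t)) ⟩
        M x (suc i) + D t * (δ x a - δ x (suc i))                 ∎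
        where
        Tb≡t : T (suc i) ≡ t
        Tb≡t = trans (cong T (sym (punchIn-inject₁-self i))) (cong proj₁ orig-b)
        shift : ∀ p α β d → p + α * d ≡ (p + β * d) + d * (α - β)
        shift = solve-∀
      M-punchIn : ∀ x k →
        M (punchIn a x) (punchIn a k) ≡ W (punchIn a x) * B (T (punchIn a x)) (T′ k) + δ x k * D (T (punchIn a x))
      M-punchIn x k = cong₂ (λ t′ e → W (punchIn a x) * B (T (punchIn a x)) t′ + e * D (T (punchIn a x)))
                            (sym (T′≡T k)) (cong b2z (eqFin-punchIn a x k))
      rows : ∀ x k → M′ x k ≡ M (punchIn a x) (punchIn a k) + δ x i * M a (punchIn a k)
      rows x k with x Fin.≟ i
      ... | yes refl = begin
        M′ x k                                          ≡⟨ cong (λ m → typeEntry m (T′ k) (δ x k)) merged-i ⟩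
        (w + v) * B t (T′ k) + δ x k * D t              ≡⟨ split w v (B t (T′ k)) (δ x k) (D t) ⟩
        (v * B t (T′ k) + δ x k * D t) + + 1 * (w * B t (T′ k) + + 0 * D t)
          ≡⟨ cong₂ _+_ (sym (trans (M-punchIn x k) (cong (λ m → typeEntry m (T′ k) (δ x k)) orig-b)))
                       (cong₂ (λ e m → e * m) (sym (δ-refl x)) (sym row-a)) ⟩
        M (punchIn a x) (punchIn a k) + δ x x * M a (punchIn a k) ∎
        where
        split : ∀ w v β d D → (w + v) * β + d * D ≡ (v * β + d * D) + + 1 * (w * β + + 0 * D)
        split = solve-∀
        row-a : M a (punchIn a k) ≡ w * B t (T′ k) + + 0 * D t
        row-a = trans (cong₂ (λ m t′ → typeEntry m t′ (δ a (punchIn a k))) orig-a (sym (T′≡T k)))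
                    (cong (λ e → w * B t (T′ k) + e * D t) (δ-≢ (punchInᵢ≢i a k ∘ sym)))
      ... | no x≢i = begin
        M′ x k                                          ≡⟨ cong (λ m → typeEntry m (T′ k) (δ x k)) (merged-≢i x x≢i) ⟩
        W (punchIn a x) * B (T (punchIn a x)) (T′ k) + δ x k * D (T (punchIn a x)) ≡⟨ sym (M-punchIn x k) ⟩
        M (punchIn a x) (punchIn a k)                   ≡⟨ sym (absorb _ (M a (punchIn a k))) ⟩
        M (punchIn a x) (punchIn a k) + + 0 * M a (punchIn a k)
          ≡⟨ cong (λ e → M (punchIn a x) (punchIn a k) + e * M a (punchIn a k)) (sym (δ-≢ x≢i)) ⟩
        M (punchIn a x) (punchIn a k) + δ x i * M a (punchIn a k) ∎
        where
        absorb : ∀ m y → m + + 0 * y ≡ m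
        absorb = solve-∀

  typeMatrix-merge : ∀ {n} (xs : List (τ × ℤ)) t w v (f : ℕ → τ × ℤ) → length xs ℕ.< n →
    det (typeMatrix {suc n} (xs ++ˢ (t , w) ∷ˢ (t , v) ∷ˢ f)) ≡ D t * det (typeMatrix {n} (xs ++ˢ (t , w + v) ∷ˢ f))
  typeMatrix-merge xs t w v f L<n = det-merge-adjacent M i (D t) M′ columns rows
    where open Merge xs t w v f L<n

  typeMatrix-collapse : ∀ {n} (xs : List (τ × ℤ)) t w k (f : ℕ → τ × ℤ) → length xs ℕ.< n →
    det (typeMatrix {k ℕ.+ n} (xs ++ˢ (t , w) ∷ˢ (replicate k (t , + 1) ++ˢ f)))
      ≡ D t ^ k * det (typeMatrix {n} (xs ++ˢ (t , w + + k) ∷ˢ f))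
  typeMatrix-collapse {n} xs t w zero f L<n = begin
    det (typeMatrix {n} (xs ++ˢ (t , w) ∷ˢ f))
      ≡⟨ det-typeMatrix-cong {n} (λ j → cong (λ w′ → (xs ++ˢ (t , w′) ∷ˢ f) j) (sym (ℤ.+-identityʳ w))) ⟩
    det (typeMatrix {n} (xs ++ˢ (t , w + + 0) ∷ˢ f))   ≡⟨ sym (ℤ.*-identityˡ _) ⟩
    + 1 * det (typeMatrix {n} (xs ++ˢ (t , w + + 0) ∷ˢ f)) ∎
  typeMatrix-collapse {n} xs t w (suc k) f L<n = begin
    det (typeMatrix {suc k ℕ.+ n} (xs ++ˢ (t , w) ∷ˢ (t , + 1) ∷ˢ (replicate k (t , + 1) ++ˢ f)))
      ≡⟨ typeMatrix-merge xs t w (+ 1) _ (ℕ.m≤n⇒m≤o+n k L<n) ⟩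
    D t * det (typeMatrix {k ℕ.+ n} (xs ++ˢ (t , w + + 1) ∷ˢ (replicate k (t , + 1) ++ˢ f)))
      ≡⟨ cong (D t *_) (typeMatrix-collapse xs t (w + + 1) k f L<n) ⟩
    D t * (D t ^ k * det (typeMatrix {n} (xs ++ˢ (t , w + + 1 + + k) ∷ˢ f)))
      ≡⟨ sym (ℤ.*-assoc (D t) (D t ^ k) _) ⟩
    D t ^ suc k * det (typeMatrix {n} (xs ++ˢ (t , w + + 1 + + k) ∷ˢ f))
      ≡⟨ cong (D t ^ suc k *_)
              (det-typeMatrix-cong {n} λ j → cong (λ w′ → (xs ++ˢ (t , w′) ∷ˢ f) j) (ℤ.+-assoc w (+ 1) (+ k))) ⟩
    D t ^ suc k * det (typeMatrix {n} (xs ++ˢ (t , w + + suc k) ∷ˢ f)) ∎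

typeGraph : ∀ {τ : Set} → (τ → τ → Bool) → (ℕ → τ) → ∀ {n} → Fin n → Fin n → Bool
typeGraph adj T u v = not (eqFin u v) ∧ adj (T (toℕ u)) (T (toℕ v))

degree-loopless : ∀ {n} (u : Fin n) (X : Fin n → Bool) →
  ∑ (λ v → b2z (not (eqFin u v) ∧ X v)) ≡ ∑ (λ v → b2z (X v)) - b2z (X u)
degree-loopless {suc n} u X = begin
  ∑ (λ v → b2z (not (eqFin u v) ∧ X v))
    ≡⟨ ∑-punchIn (λ v → b2z (not (eqFin u v) ∧ X v)) u ⟩
  b2z (not (eqFin u u) ∧ X u) + ∑ (λ k → b2z (not (eqFin u (punchIn u k)) ∧ X (punchIn u k)))
    ≡⟨ cong₂ _+_ (cong (λ e → b2z (not e ∧ X u)) (eqFin-refl u))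
                 (∑-cong λ k → cong (λ e → b2z (not e ∧ X (punchIn u k))) (eqFin-≢ (punchInᵢ≢i u k ∘ sym))) ⟩
  + 0 + ∑ (λ k → b2z (X (punchIn u k)))   ≡⟨ rearrange (b2z (X u)) _ ⟩
  (b2z (X u) + ∑ (λ k → b2z (X (punchIn u k)))) - b2z (X u) ≡⟨ cong (_- b2z (X u)) (sym (∑-punchIn (λ v → b2z (X v)) u)) ⟩
  ∑ (λ v → b2z (X v)) - b2z (X u)         ∎
  where
  rearrange : ∀ x s → + 0 + s ≡ (x + s) - x
  rearrange = solve-∀

module _ {τ : Set} (adj : τ → τ → Bool) (T : ℕ → τ) {n : ℕ} where

  open TypeMatrix (λ t t′ → b2z (adj t t′))

  charPoly-typeGraph : (θ : τ → ℤ) → (∀ t → ∑ (λ (v : Fin n) → b2z (adj t (T (toℕ v)))) ≡ θ t) →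
    ∀ z → charPoly (typeGraph adj T {n}) z ≡ det (typeMatrix (λ t → z - θ t) {n} (λ j → T j , + 1))
  charPoly-typeGraph θ degree≡ z = det-cong entry
    where
    B : Fin n → Fin n → ℤ
    B u v = b2z (adj (T (toℕ u)) (T (toℕ v)))
    entry : ∀ u v → (if eqFin u v then z else + 0) - laplacian (typeGraph adj T) u v
                    ≡ + 1 * B u v + δ u v * (z - θ (T (toℕ u)))
    entry u v with u Fin.≟ v
    ... | yes refl rewrite eqFin-refl u = begin
      z - degree (typeGraph adj T) u                   ≡⟨ cong (_-_ z) (degree-loopless u λ v → adj (T (toℕ u)) (T (toℕ v))) ⟩
      z - (∑ (λ v → B u v) - B u u)                    ≡⟨ cong (λ d → z - (d - B u u)) (degree≡ (T (toℕ u))) ⟩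
      z - (θ (T (toℕ u)) - B u u)                      ≡⟨ diagonal z (θ (T (toℕ u))) (B u u) ⟩
      + 1 * B u u + + 1 * (z - θ (T (toℕ u)))          ∎
      where
      diagonal : ∀ z θ b → z - (θ - b) ≡ + 1 * b + + 1 * (z - θ)
      diagonal = solve-∀
    ... | no u≢v rewrite eqFin-≢ u≢v = offDiagonal z (B u v) (z - θ (T (toℕ u)))
      where
      offDiagonal : ∀ z b e → + 0 - - b ≡ + 1 * b + + 0 * e
      offDiagonal = solve-∀

DividesDifferences : (ℤ → ℤ) → Set
DividesDifferences f = ∀ x y → (x - y) ∣ (f x - f y)

const-dividesDifferences : ∀ c → DividesDifferences (λ _ → c)
const-dividesDifferences c x y = subst (_∣_ (x - y)) (sym (ℤ.+-inverseʳ c)) (divides (+ 0) (sym (ℤ.*-zeroˡ (x - y))))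

id-dividesDifferences : DividesDifferences (λ z → z)
id-dividesDifferences x y = ∣-refl

+-dividesDifferences : ∀ {f g} → DividesDifferences f → DividesDifferences g → DividesDifferences (λ z → f z + g z)
+-dividesDifferences {f} {g} df dg x y =
  subst (_∣_ (x - y)) (sym (regroup (f x) (f y) (g x) (g y))) (∣m∣n⇒∣m+n (df x y) (dg x y))
  where
  regroup : ∀ a b c d → (a + c) - (b + d) ≡ (a - b) + (c - d)
  regroup = solve-∀

*-dividesDifferences : ∀ {f g} → DividesDifferences f → DividesDifferences g → DividesDifferences (λ z → f z * g z)
*-dividesDifferences {f} {g} df dg x y =
  subst (_∣_ (x - y)) (sym (leibniz (f x) (f y) (g x) (g y)))
    (∣m∣n⇒∣m+n (∣n⇒∣m*n (f x) (dg x y)) (∣n⇒∣m*n (g y) (df x y)))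
  where
  leibniz : ∀ a b c d → a * c - b * d ≡ a * (c - d) + d * (a - b)
  leibniz = solve-∀

evalPoly-dividesDifferences : ∀ cs → DividesDifferences (evalPoly cs)
evalPoly-dividesDifferences []       = const-dividesDifferences (+ 0)
evalPoly-dividesDifferences (c ∷ cs) =
  +-dividesDifferences {λ _ → c} (const-dividesDifferences c)
    (*-dividesDifferences {λ z → z} id-dividesDifferences (evalPoly-dividesDifferences cs))

linProd-dividesDifferences : ∀ as → DividesDifferences (linProd as)
linProd-dividesDifferences []       = const-dividesDifferences (+ 1)
linProd-dividesDifferences (a ∷ as) =
  *-dividesDifferences {λ z → z - a}
    (+-dividesDifferences {λ z → z} id-dividesDifferences (const-dividesDifferences (- a))) (linProd-dividesDifferences as)

suc∣⇒≡0 : ∀ n → suc n ℕ.∣ n → n ≡ 0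
suc∣⇒≡0 zero    _          = refl
suc∣⇒≡0 (suc n) 2+n∣1+n = ⊥-elim (ℕ.<-irrefl refl (ℕ.∣⇒≤ 2+n∣1+n))

cancel-linearFactor-≢ : ∀ {F G : ℤ → ℤ} a → (∀ z → (z - a) * F z ≡ (z - a) * G z) → ∀ z → z ≢ a → F z ≡ G z
cancel-linearFactor-≢ {F} {G} a eq z z≢a =
  ℤ.*-cancelˡ-≡ (z - a) (F z) (G z) {{ℤ.≢-nonZero λ z-a≡0 → z≢a (ℤ.i-j≡0⇒i≡j z a z-a≡0)}} (eq z)

-- At z = a, the point w = a + 1 + ∣F a − G a∣ has F w = G w, so w − a divides F a − G a.
cancel-linearFactor : ∀ {F G} → DividesDifferences F → DividesDifferences G → ∀ a →
  (∀ z → (z - a) * F z ≡ (z - a) * G z) → ∀ z → F z ≡ G z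
cancel-linearFactor {F} {G} dF dG a eq z with z ℤ.≟ a
... | no z≢a   = cancel-linearFactor-≢ a eq z z≢a
... | yes refl = ℤ.i-j≡0⇒i≡j (F a) (G a) (ℤ.∣i∣≡0⇒i≡0 (suc∣⇒≡0 n (∣⇒∣ᵤ gap∣)))
  where
  n = ∣ F a - G a ∣
  w = a + + suc n
  w-a : w - a ≡ + suc n
  w-a = cancelˡ a (+ suc n)
    where
    cancelˡ : ∀ a k → (a + k) - a ≡ k
    cancelˡ = solve-∀
  Fw≡Gw : F w ≡ G w
  Fw≡Gw = cancel-linearFactor-≢ a eq w λ w≡a → ℕ.1+n≢0 (ℤ.+-injective (trans (sym w-a) (ℤ.i≡j⇒i-j≡0 w≡a)))
  gap∣ : + suc n ∣ (F a - G a)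
  gap∣ = subst (_∣ (F a - G a)) w-a
    (subst (_∣_ (w - a)) (trans (cong (λ x → (G w - G a) - (x - F a)) Fw≡Gw) (collapse (G w) (F a) (G a)))
             (∣m∣n⇒∣m-n (dG w a) (dF w a)))
    where
    collapse : ∀ g f h → (g - h) - (g - f) ≡ f - h
    collapse = solve-∀

linProd-root : ∀ bs a → linProd bs a ≡ + 0 →
  ∃ λ bs′ → (∀ z → linProd bs z ≡ (z - a) * linProd bs′ z) × length bs ≡ suc (length bs′)
linProd-root (b ∷ bs) a root with ℤ.i*j≡0⇒i≡0∨j≡0 (a - b) root
... | inj₁ a-b≡0 with refl ← ℤ.i-j≡0⇒i≡j a b a-b≡0 = bs , (λ z → refl) , refl
... | inj₂ rest≡0 with bs′ , factor , len ← linProd-root bs a rest≡0 =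
  b ∷ bs′ , (λ z → trans (cong ((z - b) *_) (factor z)) (swap (z - b) (z - a) (linProd bs′ z))) , cong suc len
  where
  swap : ∀ x y r → x * (y * r) ≡ y * (x * r)
  swap = solve-∀

linProd-root-*-≡0 : ∀ a as x → linProd (a ∷ as) a * x ≡ + 0
linProd-root-*-≡0 a as x = vanish a (linProd as a) x
  where
  vanish : ∀ a y x → (a - a) * y * x ≡ + 0
  vanish = solve-∀

linProd-factors-length : ∀ as bs {F G} → DividesDifferences F → DividesDifferences G →
  (∀ z → F z ≢ + 0) → (∀ z → G z ≢ + 0) →
  (∀ z → linProd as z * F z ≡ linProd bs z * G z) → length as ≡ length bs
linProd-factors-length []       []       dF dG F≢0 G≢0 eq = refl
linProd-factors-length []       (b ∷ bs) {F} {G} dF dG F≢0 G≢0 eq =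
  ⊥-elim (F≢0 b (trans (sym (ℤ.*-identityˡ (F b))) (trans (eq b) (linProd-root-*-≡0 b bs (G b)))))
linProd-factors-length (a ∷ as) bs {F} {G} dF dG F≢0 G≢0 eq
  with ℤ.i*j≡0⇒i≡0∨j≡0 (linProd bs a) (trans (sym (eq a)) (linProd-root-*-≡0 a as (F a)))
... | inj₂ Ga≡0 = ⊥-elim (G≢0 a Ga≡0)
... | inj₁ root with bs′ , factor , len ← linProd-root bs a root =
  trans (cong suc (linProd-factors-length as bs′ dF dG F≢0 G≢0 cancelled)) (sym len)
  where
  reassoc : ∀ x y f → x * y * f ≡ x * (y * f)
  reassoc = solve-∀
  cancelled : ∀ z → linProd as z * F z ≡ linProd bs′ z * G z
  cancelled = cancel-linearFactor (*-dividesDifferences {linProd as} (linProd-dividesDifferences as) dF)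
                                  (*-dividesDifferences {linProd bs′} (linProd-dividesDifferences bs′) dG) a λ z → begin
    (z - a) * (linProd as z * F z)   ≡⟨ sym (reassoc (z - a) _ _) ⟩
    (z - a) * linProd as z * F z     ≡⟨ eq z ⟩
    linProd bs z * G z               ≡⟨ cong (_* G z) (factor z) ⟩
    (z - a) * linProd bs′ z * G z    ≡⟨ reassoc (z - a) _ _ ⟩
    (z - a) * (linProd bs′ z * G z)  ∎

IntRootCount-unique : ∀ {f m n} → IntRootCount f m → IntRootCount f n → m ≡ n
IntRootCount-unique (as , q , refl , f≡ , q≢0) (bs , r , refl , f≡′ , r≢0) =
  linProd-factors-length as bs (evalPoly-dividesDifferences q) (evalPoly-dividesDifferences r) q≢0 r≢0
    λ z → trans (sym (f≡ z)) (f≡′ z)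

monicQuadratic : ℕ → ℕ → ℤ → ℤ
monicQuadratic b c z = z * z - + b * z + + c

-- Integer roots lie in [0, b] because c ≥ 0, so a bounded search decides whether there is one.
monicQuadratic-splits-or-rootless : ∀ b c →
  (∃ λ r → ∀ z → monicQuadratic b c z ≡ linProd (r ∷ + b - r ∷ []) z) ⊎ (∀ z → monicQuadratic b c z ≢ + 0)
monicQuadratic-splits-or-rootless b c with ℕ.anyUpTo? (λ n → monicQuadratic b c (+ n) ℤ.≟ + 0) (suc b)
... | yes (r , _ , root) = inj₁ (+ r , λ z → begin
  monicQuadratic b c z                                            ≡⟨ split z (+ r) (+ b) (+ c) ⟩
  linProd (+ r ∷ + b - + r ∷ []) z + monicQuadratic b c (+ r)     ≡⟨ cong (_+_ (linProd (+ r ∷ + b - + r ∷ []) z)) root ⟩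
  linProd (+ r ∷ + b - + r ∷ []) z + + 0                          ≡⟨ ℤ.+-identityʳ _ ⟩
  linProd (+ r ∷ + b - + r ∷ []) z                                ∎)
  where
  split : ∀ z r b c → z * z - b * z + c ≡ (z - r) * ((z - (b - r)) * + 1) + (r * r - b * r + c)
  split = solve-∀
... | no noSmallRoot = inj₂ rootless
  where
  rootless : ∀ z → monicQuadratic b c z ≢ + 0
  rootless (+ n) root with n ℕ.≤? b
  ... | yes n≤b = noSmallRoot (n , s≤s n≤b , root)
  ... | no n≰b  = ℕ.<-irrefl (sym balance) (ℕ.<-≤-trans (ℕ.*-monoˡ-< n {{nonZero}} b<n) (ℕ.m≤m+n (n ℕ.* n) c))
    where
    b<n = ℕ.≰⇒> n≰b
    nonZero : ℕ.NonZero n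
    nonZero = ℕ.>-nonZero (ℕ.<-≤-trans (s≤s ℕ.z≤n) b<n)
    balance : n ℕ.* n ℕ.+ c ≡ b ℕ.* n
    balance = ℤ.+-injective (begin
      + (n ℕ.* n ℕ.+ c)              ≡⟨ trans (ℤ.pos-+ (n ℕ.* n) c) (cong (_+ + c) (ℤ.pos-* n n)) ⟩
      + n * + n + + c                ≡⟨ rearrange (+ n * + n) (+ b * + n) (+ c) ⟩
      monicQuadratic b c (+ n) + + b * + n ≡⟨ cong (_+ + b * + n) root ⟩
      + 0 + + b * + n                ≡⟨ ℤ.+-identityˡ _ ⟩
      + b * + n                      ≡⟨ sym (ℤ.pos-* b n) ⟩
      + (b ℕ.* n)                    ∎)
      where
      rearrange : ∀ x y c → x + c ≡ (x - y + c) + y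
      rearrange = solve-∀
  rootless -[1+ k ] root with ℤ.+-injective (trans positive root)
    where
    K = suc k
    positive : + (K ℕ.* K ℕ.+ b ℕ.* K ℕ.+ c) ≡ monicQuadratic b c -[1+ k ]
    positive = begin
      + (K ℕ.* K ℕ.+ b ℕ.* K ℕ.+ c)
        ≡⟨ trans (ℤ.pos-+ (K ℕ.* K ℕ.+ b ℕ.* K) c) (cong (_+ + c) (ℤ.pos-+ (K ℕ.* K) (b ℕ.* K))) ⟩
      + (K ℕ.* K) + + (b ℕ.* K) + + c ≡⟨ cong₂ (λ x y → x + y + + c) (ℤ.pos-* K K) (ℤ.pos-* b K) ⟩
      + K * + K + + b * + K + + c    ≡⟨ negate (+ K) (+ b) (+ c) ⟩
      monicQuadratic b c -[1+ k ]    ∎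
      where
      negate : ∀ k b c → k * k + b * k + c ≡ (- k) * (- k) - b * (- k) + c
      negate = solve-∀
  ... | ()

adjℤ : Part → Part → ℤ
adjℤ t t′ = b2z (adjPart t t′)

classDegree : ℤ → ℤ → Part → ℤ
classDegree ws wp t = ws * adjℤ t S₁ + (ws * adjℤ t S₂ + (wp * adjℤ t P₁ + wp * adjℤ t P₂))

-- The stream left by collapsing the four blocks of gminClasses.
quotientClasses : ℤ → ℤ → ℕ → Part × ℤ
quotientClasses ws wp = ((S₁ , ws) ∷ (S₂ , ws) ∷ (P₁ , wp) ∷ []) ++ˢ (P₂ , wp) ∷ˢ λ _ → (P₂ , + 1)

module _ (ws wp z : ℤ) where
  open TypeMatrix adjℤ (λ t → z - classDegree ws wp t)

  det-quotient : det (typeMatrix {4} (quotientClasses ws wp)) ≡ z * (z - ws - wp) * (z * z - (+ 3 * ws + wp) * z + + 2 * ws * ws)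
  det-quotient = prove (ws ∷ wp ∷ z ∷ []) (detᴾ Qᴾ) rhsᴾ refl
    where
    wsᴾ wpᴾ zᴾ : Polynomial 3
    wsᴾ = var zero
    wpᴾ = var (suc zero)
    zᴾ  = var (suc (suc zero))
    type : Fin 4 → Part
    type u = proj₁ (quotientClasses ws wp (toℕ u))
    weightᴾ : Fin 4 → Polynomial 3
    weightᴾ zero          = wsᴾ
    weightᴾ (suc zero)    = wsᴾ
    weightᴾ (suc (suc _)) = wpᴾ
    classDegreeᴾ : Part → Polynomial 3
    classDegreeᴾ t =
      wsᴾ :* con (adjℤ t S₁) :+ (wsᴾ :* con (adjℤ t S₂) :+ (wpᴾ :* con (adjℤ t P₁) :+ wpᴾ :* con (adjℤ t P₂)))
    Qᴾ : Fin 4 → Fin 4 → Polynomial 3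
    Qᴾ u v = weightᴾ u :* con (adjℤ (type u) (type v)) :+ con (δ u v) :* (zᴾ :- classDegreeᴾ (type u))
    rhsᴾ : Polynomial 3
    rhsᴾ = zᴾ :* (zᴾ :- wsᴾ :- wpᴾ) :* (zᴾ :* zᴾ :- (con (+ 3) :* wsᴾ :+ wpᴾ) :* zᴾ :+ con (+ 2) :* wsᴾ :* wsᴾ)

-- The constant tail lies beyond the 2s + 2p vertices and is never read.
gminClasses : ℕ → ℕ → ℕ → Part × ℤ
gminClasses s p =
  replicate s (S₁ , + 1) ++ˢ replicate s (S₂ , + 1) ++ˢ replicate p (P₁ , + 1) ++ˢ replicate p (P₂ , + 1)
    ++ˢ λ _ → (P₂ , + 1)

part-gminClasses : ∀ s p j → (part s p j , + 1) ≡ gminClasses s p j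
part-gminClasses s p = if-<ᵇ-replicate φ s S₁ _ _ λ j →
  trans (cong (λ b → φ (if b then S₂ else P (s ℕ.+ j))) (+-<ᵇ-cancelˡ s j s))
        (if-<ᵇ-replicate φ s S₂ (P ∘ (s ℕ.+_)) _ (λ j′ →
           trans (cong (λ b → φ (if b then P₁ else P₂)) (P-shift j′))
                 (if-<ᵇ-replicate φ p P₁ (λ _ → P₂) _ (λ j″ → sym (replicate-++ˢ-const p (φ P₂) j″)) j′)) j)
  where
  φ : Part → Part × ℤ
  φ t = t , + 1
  P : ℕ → Part
  P v = if v <ᵇ s ℕ.+ s ℕ.+ p then P₁ else P₂
  P-shift : ∀ j → (s ℕ.+ (s ℕ.+ j) <ᵇ s ℕ.+ s ℕ.+ p) ≡ (j <ᵇ p)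
  P-shift j = trans (cong (s ℕ.+ (s ℕ.+ j) <ᵇ_) (ℕ.+-assoc s s p))
                    (trans (+-<ᵇ-cancelˡ s (s ℕ.+ j) (s ℕ.+ p)) (+-<ᵇ-cancelˡ s j p))

gmin-degree : ∀ s p t → ∑ {order s p} (λ v → adjℤ t (part s p (toℕ v))) ≡ classDegree (+ s) (+ p) t
gmin-degree s p t = begin
  ∑ {order s p} (λ v → adjℤ t (part s p (toℕ v)))
    ≡⟨ ∑-cong {order s p} (λ v → cong h (part-gminClasses s p (toℕ v))) ⟩
  ∑ {order s p} (λ v → h (gminClasses s p (toℕ v))) ≡⟨ ∑-resize (h ∘ gminClasses s p) (reassoc s p) ⟩
  ∑ {s ℕ.+ (s ℕ.+ (p ℕ.+ (p ℕ.+ 0)))} (λ v → h (gminClasses s p (toℕ v)))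
    ≡⟨ ∑-replicate-++ˢ h s (S₁ , + 1) blocks₂ ⟩
  + s * adjℤ t S₁ + ∑ {s ℕ.+ (p ℕ.+ (p ℕ.+ 0))} (λ v → h (blocks₂ (toℕ v)))
    ≡⟨ cong (_+_ (+ s * adjℤ t S₁)) (∑-replicate-++ˢ h s (S₂ , + 1) blocks₃) ⟩
  + s * adjℤ t S₁ + (+ s * adjℤ t S₂ + ∑ {p ℕ.+ (p ℕ.+ 0)} (λ v → h (blocks₃ (toℕ v))))
    ≡⟨ cong (λ x → + s * adjℤ t S₁ + (+ s * adjℤ t S₂ + x)) (∑-replicate-++ˢ h p (P₁ , + 1) blocks₄) ⟩
  + s * adjℤ t S₁ + (+ s * adjℤ t S₂ + (+ p * adjℤ t P₁ + ∑ {p ℕ.+ 0} (λ v → h (blocks₄ (toℕ v)))))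
    ≡⟨ cong (λ x → + s * adjℤ t S₁ + (+ s * adjℤ t S₂ + (+ p * adjℤ t P₁ + x)))
            (trans (∑-replicate-++ˢ h p (P₂ , + 1) (λ _ → (P₂ , + 1))) (ℤ.+-identityʳ _)) ⟩
  classDegree (+ s) (+ p) t                          ∎
  where
  h : Part × ℤ → ℤ
  h = adjℤ t ∘ proj₁
  blocks₂ blocks₃ blocks₄ : ℕ → Part × ℤ
  blocks₂ = replicate s (S₂ , + 1) ++ˢ blocks₃
  blocks₃ = replicate p (P₁ , + 1) ++ˢ blocks₄
  blocks₄ = replicate p (P₂ , + 1) ++ˢ λ _ → (P₂ , + 1)
  reassoc : ∀ s p → s ℕ.+ s ℕ.+ p ℕ.+ p ≡ s ℕ.+ (s ℕ.+ (p ℕ.+ (p ℕ.+ 0)))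
  reassoc = ℕ-Solver.solve-∀

module _ (s′ p′ : ℕ) (z : ℤ) where

  private
    s = suc s′
    p = suc p′

  eigenFactor : Part → ℤ
  eigenFactor t = z - classDegree (+ s) (+ p) t

  open TypeMatrix adjℤ eigenFactor

  charPoly-Gmin : charPoly (Gmin s p) z ≡
    eigenFactor S₁ ^ s′ * (eigenFactor S₂ ^ s′ * (eigenFactor P₁ ^ p′ * (eigenFactor P₂ ^ p′ *
      (z * (z - + s - + p) * (z * z - (+ 3 * + s + + p) * z + + 2 * + s * + s)))))
  charPoly-Gmin = begin
    charPoly (Gmin s p) z
      ≡⟨ charPoly-typeGraph adjPart (part s p) {order s p} (classDegree (+ s) (+ p)) (gmin-degree s p) z ⟩
    det (typeMatrix {order s p} (λ j → part s p j , + 1))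
      ≡⟨ det-typeMatrix-cong {order s p} (part-gminClasses s p) ⟩
    det (typeMatrix {order s p} (gminClasses s p))
      ≡⟨ det-typeMatrix-resize (gminClasses s p) (size s′ p′) ⟩
    det (typeMatrix {s′ ℕ.+ (s′ ℕ.+ (p′ ℕ.+ (p′ ℕ.+ 4)))} (gminClasses s p))
      ≡⟨ collapse-blocks ⟩
    eigenFactor S₁ ^ s′ * (eigenFactor S₂ ^ s′ * (eigenFactor P₁ ^ p′ * (eigenFactor P₂ ^ p′ *
      det (typeMatrix {4} (quotientClasses (+ s) (+ p))))))
      ≡⟨ cong (λ d → eigenFactor S₁ ^ s′ * (eigenFactor S₂ ^ s′ * (eigenFactor P₁ ^ p′ * (eigenFactor P₂ ^ p′ * d))))
              (det-quotient (+ s) (+ p) z) ⟩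
    eigenFactor S₁ ^ s′ * (eigenFactor S₂ ^ s′ * (eigenFactor P₁ ^ p′ * (eigenFactor P₂ ^ p′ *
      (z * (z - + s - + p) * (z * z - (+ 3 * + s + + p) * z + + 2 * + s * + s))))) ∎
    where
    size : ∀ a b → suc a ℕ.+ suc a ℕ.+ suc b ℕ.+ suc b ≡ a ℕ.+ (a ℕ.+ (b ℕ.+ (b ℕ.+ 4)))
    size = ℕ-Solver.solve-∀
    collapse-blocks : det (typeMatrix {s′ ℕ.+ (s′ ℕ.+ (p′ ℕ.+ (p′ ℕ.+ 4)))} (gminClasses s p)) ≡
      eigenFactor S₁ ^ s′ * (eigenFactor S₂ ^ s′ * (eigenFactor P₁ ^ p′ * (eigenFactor P₂ ^ p′ *
        det (typeMatrix {4} (quotientClasses (+ s) (+ p))))))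
    collapse-blocks =
      trans (typeMatrix-collapse [] S₁ (+ 1) s′ _ (ℕ.m≤n⇒m≤o+n s′ (ℕ.m≤n⇒m≤o+n p′ (ℕ.m≤n⇒m≤o+n p′ (s≤s z≤n)))))
      (cong (eigenFactor S₁ ^ s′ *_)
      (trans (typeMatrix-collapse ((S₁ , + s) ∷ []) S₂ (+ 1) s′ _ (ℕ.m≤n⇒m≤o+n p′ (ℕ.m≤n⇒m≤o+n p′ (s≤s (s≤s z≤n)))))
      (cong (eigenFactor S₂ ^ s′ *_)
      (trans (typeMatrix-collapse ((S₁ , + s) ∷ (S₂ , + s) ∷ []) P₁ (+ 1) p′ _ (ℕ.m≤n⇒m≤o+n p′ (s≤s (s≤s (s≤s z≤n)))))
      (cong (eigenFactor P₁ ^ p′ *_)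
      (typeMatrix-collapse ((S₁ , + s) ∷ (S₂ , + s) ∷ (P₁ , + p) ∷ []) P₂ (+ 1) p′ _ ℕ.≤-refl))))))

linProd-++ : ∀ xs ys z → linProd (xs ++ ys) z ≡ linProd xs z * linProd ys z
linProd-++ []       ys z = sym (ℤ.*-identityˡ (linProd ys z))
linProd-++ (x ∷ xs) ys z = trans (cong ((z - x) *_) (linProd-++ xs ys z)) (sym (ℤ.*-assoc (z - x) _ _))

linProd-replicate : ∀ k c z → linProd (replicate k c) z ≡ (z - c) ^ k
linProd-replicate zero    c z = refl
linProd-replicate (suc k) c z = cong ((z - c) *_) (linProd-replicate k c z)

module _ (s′ p′ : ℕ) where

  private
    s = suc s′
    p = suc p′
    θ = classDegree (+ s) (+ p)

  gminIntegerEigenvalues : List ℤ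
  gminIntegerEigenvalues =
    replicate s′ (θ S₁) ++ replicate s′ (θ S₂) ++ replicate p′ (θ P₁) ++ replicate p′ (θ P₂) ++ + 0 ∷ + s + + p ∷ []

  length-gminIntegerEigenvalues : length gminIntegerEigenvalues ℕ.+ 2 ≡ order s p
  length-gminIntegerEigenvalues = begin
    length gminIntegerEigenvalues ℕ.+ 2  ≡⟨ cong (ℕ._+ 2) lengths ⟩
    s′ ℕ.+ (s′ ℕ.+ (p′ ℕ.+ (p′ ℕ.+ 2))) ℕ.+ 2 ≡⟨ arrange s′ p′ ⟩
    order s p                            ∎
    where
    arrange : ∀ a b → a ℕ.+ (a ℕ.+ (b ℕ.+ (b ℕ.+ 2))) ℕ.+ 2 ≡ suc a ℕ.+ suc a ℕ.+ suc b ℕ.+ suc b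
    arrange = ℕ-Solver.solve-∀
    length-block : ∀ k c ys → length (replicate k c ++ ys) ≡ k ℕ.+ length ys
    length-block k c ys = trans (List.length-++ (replicate k c)) (cong (ℕ._+ length ys) (List.length-replicate k))
    lengths : length gminIntegerEigenvalues ≡ s′ ℕ.+ (s′ ℕ.+ (p′ ℕ.+ (p′ ℕ.+ 2)))
    lengths = trans (length-block s′ _ _) (cong (s′ ℕ.+_) (trans (length-block s′ _ _)
                (cong (s′ ℕ.+_) (trans (length-block p′ _ _) (cong (p′ ℕ.+_) (length-block p′ _ _))))))

  charPoly-Gmin-factorisation : ∀ z →
    charPoly (Gmin s p) z ≡ linProd gminIntegerEigenvalues z * monicQuadratic (3 ℕ.* s ℕ.+ p) (2 ℕ.* s ℕ.* s) z
  charPoly-Gmin-factorisation z = begin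
    charPoly (Gmin s p) z ≡⟨ charPoly-Gmin s′ p′ z ⟩
    E S₁ ^ s′ * (E S₂ ^ s′ * (E P₁ ^ p′ * (E P₂ ^ p′ * (z * (z - + s - + p) * Q))))
      ≡⟨ regroup (E S₁ ^ s′) (E S₂ ^ s′) (E P₁ ^ p′) (E P₂ ^ p′) z (+ s) (+ p) Q ⟩
    E S₁ ^ s′ * (E S₂ ^ s′ * (E P₁ ^ p′ * (E P₂ ^ p′ * ((z - + 0) * ((z - (+ s + + p)) * + 1))))) * Q
      ≡⟨ cong₂ _*_ (sym eigenvalues) (cong₂ (λ b c → z * z - b * z + c) (sym (pos-3s+p)) (sym (pos-2ss))) ⟩
    linProd gminIntegerEigenvalues z * monicQuadratic (3 ℕ.* s ℕ.+ p) (2 ℕ.* s ℕ.* s) z ∎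
    where
    E = eigenFactor s′ p′ z
    Q = z * z - (+ 3 * + s + + p) * z + + 2 * + s * + s
    regroup : ∀ a b c d z s p q → a * (b * (c * (d * (z * (z - s - p) * q)))) ≡
                                  a * (b * (c * (d * ((z - + 0) * ((z - (s + p)) * + 1))))) * q
    regroup = solve-∀
    pos-3s+p : + (3 ℕ.* s ℕ.+ p) ≡ + 3 * + s + + p
    pos-3s+p = trans (ℤ.pos-+ (3 ℕ.* s) p) (cong (_+ + p) (ℤ.pos-* 3 s))
    pos-2ss : + (2 ℕ.* s ℕ.* s) ≡ + 2 * + s * + s
    pos-2ss = trans (ℤ.pos-* (2 ℕ.* s) s) (cong (_* + s) (ℤ.pos-* 2 s))
    eigenvalues : linProd gminIntegerEigenvalues z ≡
      E S₁ ^ s′ * (E S₂ ^ s′ * (E P₁ ^ p′ * (E P₂ ^ p′ * ((z - + 0) * ((z - (+ s + + p)) * + 1)))))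
    eigenvalues = trans (linProd-++ (replicate s′ (θ S₁)) _ z) (cong₂ _*_ (linProd-replicate s′ _ z)
                 (trans (linProd-++ (replicate s′ (θ S₂)) _ z) (cong₂ _*_ (linProd-replicate s′ _ z)
                 (trans (linProd-++ (replicate p′ (θ P₁)) _ z) (cong₂ _*_ (linProd-replicate p′ _ z)
                 (trans (linProd-++ (replicate p′ (θ P₂)) _ z) (cong₂ _*_ (linProd-replicate p′ _ z) refl)))))))

  Gmin-intRootCount : Σ ℕ λ m → IntRootCount (charPoly (Gmin s p)) m × (order s p ∸ m ≡ 0 ⊎ order s p ∸ m ≡ 2)
  Gmin-intRootCount with monicQuadratic-splits-or-rootless (3 ℕ.* s ℕ.+ p) (2 ℕ.* s ℕ.* s)
  ... | inj₁ (r , splits) = length roots , (roots , + 1 ∷ [] , refl , factorisation , one≢0) , inj₁ no-defect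
    where
    roots = gminIntegerEigenvalues ++ r ∷ + (3 ℕ.* s ℕ.+ p) - r ∷ []
    evalPoly-one : ∀ z → evalPoly (+ 1 ∷ []) z ≡ + 1
    evalPoly-one z = cong (_+_ (+ 1)) (ℤ.*-zeroʳ z)
    one≢0 : ∀ z → evalPoly (+ 1 ∷ []) z ≢ + 0
    one≢0 z eq with () ← trans (sym (evalPoly-one z)) eq
    factorisation : ∀ z → charPoly (Gmin s p) z ≡ linProd roots z * evalPoly (+ 1 ∷ []) z
    factorisation z = begin
      charPoly (Gmin s p) z  ≡⟨ charPoly-Gmin-factorisation z ⟩
      linProd gminIntegerEigenvalues z * monicQuadratic (3 ℕ.* s ℕ.+ p) (2 ℕ.* s ℕ.* s) z
        ≡⟨ cong (linProd gminIntegerEigenvalues z *_) (splits z) ⟩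
      linProd gminIntegerEigenvalues z * linProd (r ∷ + (3 ℕ.* s ℕ.+ p) - r ∷ []) z
        ≡⟨ sym (linProd-++ gminIntegerEigenvalues _ z) ⟩
      linProd roots z                 ≡⟨ sym (trans (cong (linProd roots z *_) (evalPoly-one z)) (ℤ.*-identityʳ _)) ⟩
      linProd roots z * evalPoly (+ 1 ∷ []) z ∎
    no-defect : order s p ∸ length roots ≡ 0
    no-defect = begin
      order s p ∸ length roots  ≡⟨ cong (order s p ∸_) (List.length-++ gminIntegerEigenvalues) ⟩
      order s p ∸ (length gminIntegerEigenvalues ℕ.+ 2) ≡⟨ cong (order s p ∸_) length-gminIntegerEigenvalues ⟩
      order s p ∸ order s p     ≡⟨ ℕ.n∸n≡0 (order s p) ⟩
      0                         ∎
  ... | inj₂ rootless = length gminIntegerEigenvalues ,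
          (gminIntegerEigenvalues , coefficients , refl , factorisation , λ z → rootless z ∘ trans (sym (evalPoly-coefficients z))) ,
          inj₂ defect
    where
    coefficients = + (2 ℕ.* s ℕ.* s) ∷ - + (3 ℕ.* s ℕ.+ p) ∷ + 1 ∷ []
    evalPoly-coefficients : ∀ z → evalPoly coefficients z ≡ monicQuadratic (3 ℕ.* s ℕ.+ p) (2 ℕ.* s ℕ.* s) z
    evalPoly-coefficients z = horner (+ (3 ℕ.* s ℕ.+ p)) (+ (2 ℕ.* s ℕ.* s)) z
      where
      horner : ∀ b c z → c + z * (- b + z * (+ 1 + z * + 0)) ≡ z * z - b * z + c
      horner = solve-∀
    factorisation : ∀ z → charPoly (Gmin s p) z ≡ linProd gminIntegerEigenvalues z * evalPoly coefficients z
    factorisation z = trans (charPoly-Gmin-factorisation z) (cong (linProd gminIntegerEigenvalues z *_) (sym (evalPoly-coefficients z)))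
    defect : order s p ∸ length gminIntegerEigenvalues ≡ 2
    defect = trans (cong (_∸ length gminIntegerEigenvalues) (sym length-gminIntegerEigenvalues))
                   (ℕ.m+n∸m≡n (length gminIntegerEigenvalues) 2)

theorem9 : (s p : ℕ) → 2 ≤ s → 2 ≤ p →
    Σ ℕ (λ m → IntRootCount (charPoly (Gmin s p)) m)
    × ((m : ℕ) → IntRootCount (charPoly (Gmin s p)) m →
         (order s p ∸ m ≡ 0) ⊎ (order s p ∸ m ≡ 2))
theorem9 (suc s′) (suc p′) _ _ with m₀ , count₀ , defect ← Gmin-intRootCount s′ p′ =
  (m₀ , count₀) , λ m count →
    subst (λ k → (order (suc s′) (suc p′) ∸ k ≡ 0) ⊎ (order (suc s′) (suc p′) ∸ k ≡ 2))
          (IntRootCount-unique count₀ count) defect
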